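{- Let $D$ be a weakly decomposable NNF over $n$ variables such that for any two term subcircuits $T$ and $T'$ of $D$, $\mathit{var}(T)=\mathit{var}(T')$. Then there is a smooth weakly decomposable NNF $D^*$ equivalent to $D$ (computing the same Boolean function) of size $|D^*| = O(n|D|)$. Furthermore, if $D$ is deterministic, then so is $D^*$.
   Context: An NNF is a finite DAG with a single source whose sinks are labeled by $0$, $1$, a Boolean variable $x$ or its negation $\overline{x}$, and whose internal nodes have exactly two successors $g_l,g_r$ and are labeled $\lor$ or $\land$; it computes a Boolean function in the obvious way. Its size is its number of nodes. $\mathit{var}(g)$ is the set of variables $x$ such that $x$ or $\overline{x}$ labels a sink reachable from $g$; $\mathit{sat}(g)$ is the set of assignments to $\mathit{var}(g)$ satisfying the subcircuit at $g$. An $\land$-node $g$ is weakly decomposable if every $x\in\mathit{var}(g_l)\cap\mathit{var}(g_r)$ appears with a unique polarity among sinks reachable from $g$; the NNF is weakly decomposable if all its $\land$-nodes are. An $\lor$-node $g$ is smooth if $\mathit{var}(g_l)=\mathit{var}(g_r)$, deterministic if no assignment to $\mathit{var}(g)$ has restrictions to $\mathit{var}(g_l)$ and $\mathit{var}(g_r)$ in $\mathit{sat}(g_l)$ and $\mathit{sat}(g_r)$ respectively; the NNF is smooth (deterministic) if all its $\lor$-nodes are. A term subcircuit of a weakly decomposable NNF is obtained iteratively starting from the source: whenever an $\land$-node is included, both its successors are included, and whenever an $\lor$-node is included, exactly one (arbitrary) successor is included; $\mathit{var}(T)$ is the set of variables labeling sinks (positively or negatively) in $T$. -}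

module Defs where

open import Data.Nat using (ℕ; _<_)
open import Data.Fin using (Fin; toℕ)
open import Data.Bool using (Bool; true; false)
open import Data.Product using (Σ; ∃; _×_; _,_)
open import Data.Sum using (_⊎_)
open import Data.Empty using (⊥)
open import Relation.Binary.PropositionalEquality using (_≡_)
open import Relation.Binary.Construct.Closure.ReflexiveTransitive using (Star)

-- A sink is labelled by a constant  const b  (0 = false, 1 = true) or a
-- literal  lit p x  (p = true : the variable x,  p = false : its negation).

data Op : Set where
  ∧g ∨g : Op

data Label (n m : ℕ) : Set where
  const : Bool → Label n m
  lit   : Bool → Fin n → Label n m
  gate  : Op → Fin m → Fin m → Label n m

data Edge {n m : ℕ} (lab : Fin m → Label n m) : Fin m → Fin m → Set where
  edgeˡ : ∀ {g o l r} → lab g ≡ gate o l r → Edge lab g l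
  edgeʳ : ∀ {g o l r} → lab g ≡ gate o l r → Edge lab g r

record NNF (n : ℕ) : Set where
  field
    size   : ℕ
    label  : Fin size → Label n size
    source : Fin size
    -- acyclicity: nodes are numbered in a topological order
    acyclic : ∀ {g h} → Edge label g h → toℕ h < toℕ g
    reach-all : ∀ g → Star (Edge label) source g

open NNF public

module _ {n : ℕ} (D : NNF n) where

  Reach : Fin (size D) → Fin (size D) → Set
  Reach = Star (Edge (label D))

  Mentions : Fin (size D) → Fin n → Bool → Set
  Mentions g x p = ∃ λ h → Reach g h × label D h ≡ lit p x

  Var : Fin (size D) → Fin n → Set
  Var g x = ∃ λ p → Mentions g x p

  data Sat (a : Fin n → Bool) : Fin (size D) → Set where
    sat-const : ∀ {g} → label D g ≡ const true → Sat a g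
    sat-lit   : ∀ {g p x} → label D g ≡ lit p x → a x ≡ p → Sat a g
    sat-and   : ∀ {g l r} → label D g ≡ gate ∧g l r → Sat a l → Sat a r → Sat a g
    sat-orˡ   : ∀ {g l r} → label D g ≡ gate ∨g l r → Sat a l → Sat a g
    sat-orʳ   : ∀ {g l r} → label D g ≡ gate ∨g l r → Sat a r → Sat a g

  Computes : (Fin n → Bool) → Set
  Computes a = Sat a (source D)

  WeaklyDecomposable : Set
  WeaklyDecomposable =
    ∀ g l r → label D g ≡ gate ∧g l r →
    ∀ x → Var l x → Var r x → Mentions g x true → Mentions g x false → ⊥

  Smooth : Set
  Smooth =
    ∀ g l r → label D g ≡ gate ∨g l r →
    ∀ x → (Var l x → Var r x) × (Var r x → Var l x)

  Deterministic : Set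
  Deterministic =
    ∀ g l r → label D g ≡ gate ∨g l r →
    ∀ (a : Fin n → Bool) → Sat a l → Sat a r → ⊥

  -- Term subcircuits: a choice of one successor for every ∨-node
  -- (true = left, false = right); the term consists of the nodes reached
  -- from the source following both edges of ∧-nodes and the chosen edge
  -- of ∨-nodes.
  Choice : Set
  Choice = Fin (size D) → Bool

  data TermEdge (ch : Choice) : Fin (size D) → Fin (size D) → Set where
    t-andˡ : ∀ {g l r} → label D g ≡ gate ∧g l r → TermEdge ch g l
    t-andʳ : ∀ {g l r} → label D g ≡ gate ∧g l r → TermEdge ch g r
    t-orˡ  : ∀ {g l r} → label D g ≡ gate ∨g l r → ch g ≡ true  → TermEdge ch g l
    t-orʳ  : ∀ {g l r} → label D g ≡ gate ∨g l r → ch g ≡ false → TermEdge ch g r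

  InTerm : Choice → Fin (size D) → Set
  InTerm ch g = Star (TermEdge ch) (source D) g

  VarT : Choice → Fin n → Set
  VarT ch x = ∃ λ h → ∃ λ p → InTerm ch h × label D h ≡ lit p x

  UniformTermVars : Set
  UniformTermVars =
    ∀ (ch ch' : Choice) x → (VarT ch x → VarT ch' x) × (VarT ch' x → VarT ch x)

Equivalent : ∀ {n} → NNF n → NNF n → Set
Equivalent {n} D E =
  ∀ (a : Fin n → Bool) → (Computes D a → Computes E a) × (Computes E a → Computes D a)

-- Every node g of D is replaced by a block of 4(n+1) nodes whose top computes g. Below the top,
-- each side s has a chain conjoining the s-successor of g with one padding atom per variable;
-- at an ∨-node with successors l and r the left atom of x is a literal of x taken from r when
-- x ∉ var(l), and the constant 1 otherwise (symmetrically on the right). Both disjuncts then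
-- mention var(l) ∪ var(r), so the new circuit is smooth; the atoms of a chain concern distinct
-- variables absent from its successor, so weak decomposability survives, and each disjunct
-- still implies its successor, so determinism survives. Padding does not change the function:
-- take the term of D selected by a satisfying assignment, and suppose it passes through the
-- ∨-node choosing l. Since all terms have the same variables, x occurs in the term; the term
-- paths from the source to that occurrence and to the ∨-node can only branch at an ∧-node, both
-- of whose sides then mention x, so weak decomposability forces the polarity seen in r, which
-- the assignment therefore satisfies.
module Submission where

open import Defs

open import Data.Bool using (Bool; true; false; if_then_else_)
import Data.Bool as Bool
open import Data.Empty using (⊥; ⊥-elim)
open import Data.Fin using (Fin; zero; suc; toℕ; fromℕ; inject₁; combine; _≟_)
  renaming (_<_ to _<ᶠ_)
open import Data.Fin.Induction using (<-weakInduction; >-weakInduction)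
open import Data.Fin.Patterns using (0F; 1F; 2F; 3F)
open import Data.Fin.Properties
  using (combine-monoˡ-<; toℕ-combine; toℕ-inject₁; *↔×; ≤̄⇒inject₁<)
open import Data.Fin.Relation.Unary.Top
  using (View; view; ‵fromℕ; ‵inject₁; view-fromℕ; view-inject₁)
open import Data.Nat using (ℕ; suc; _*_; _≤_; _<_; z<s; s<s)
open import Data.Nat.Induction using (<-wellFounded)
open import Data.Nat.Properties
  using (*-comm; ≤-reflexive; ≤-refl; ≤-trans; <-trans; <-irrefl; <⇒≤; ≤-<-trans
        ; +-monoʳ-<)
open import Data.Product using (Σ; ∃; ∃₂; _×_; _,_; proj₁; proj₂)
open import Data.Product.Function.NonDependent.Propositional using (_×-↔_)
open import Data.Product.Relation.Binary.Lex.Strict using (×-Lex)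
open import Data.Sum using (_⊎_; inj₁; inj₂; [_,_])
import Data.Sum as Sum
open import Data.Unit using (⊤; tt)
open import Function using (id; flip; _∘_; _↔_; Inverse; mk↔ₛ′)
open import Function.Properties.Inverse using (↔-refl; ↔-trans)
open import Induction.WellFounded using (WellFounded; module All; module Subrelation)
import Relation.Binary.Construct.On as On
open import Relation.Binary.Construct.Closure.ReflexiveTransitive as Star
  using (Star; ε; _◅_; _◅◅_)
open import Relation.Binary.PropositionalEquality
  using (_≡_; refl; sym; trans; subst; subst₂; cong; cong₂)
open import Relation.Nullary using (Dec; yes; no; ¬_; ¬?; does; proof)
open import Relation.Nullary.Decidable using (map′; _×-dec_; _⊎-dec_)
open import Relation.Nullary.Reflects using (invert)

data Side : Set where
  left right : Side

pick : {A : Set} → Side → A → A → A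
pick left  a b = a
pick right a b = b

sideOf : Bool → Side
sideOf true  = left
sideOf false = right

IsSink : ∀ {n m} → Label n m → Set
IsSink (gate _ _ _) = ⊥
IsSink _            = ⊤

combine-lex : ∀ {a b} {i i′ : Fin a} {j j′ : Fin b} →
              ×-Lex _≡_ _<ᶠ_ _<ᶠ_ (i , j) (i′ , j′) → combine i j <ᶠ combine i′ j′
combine-lex (inj₁ i<i′) = combine-monoˡ-< _ _ i<i′
combine-lex {i = i} {j = j} {j′ = j′} (inj₂ (refl , j<j′)) =
  subst₂ _<_ (sym (toℕ-combine i j)) (sym (toℕ-combine i j′)) (+-monoʳ-< _ j<j′)

inject₁<suc : ∀ {k} (i : Fin k) → inject₁ i <ᶠ suc i
inject₁<suc i = ≤̄⇒inject₁< ≤-refl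

module Properties {n : ℕ} (D : NNF n) where

  private
    variable
      a : Fin n → Bool
      c g h u v w s l r : Fin (size D)
      o : Op
      x : Fin n
      p q : Bool
      ch : Choice D

  edge-wellFounded : WellFounded (flip (Edge (label D)))
  edge-wellFounded = Subrelation.wellFounded (acyclic D) (On.wellFounded toℕ <-wellFounded)

  nnf-induction : (P : Fin (size D) → Set) →
                  (∀ g → (∀ {h} → Edge (label D) g h → P h) → P g) → ∀ g → P g
  nnf-induction P = All.wfRec edge-wellFounded _ P

  reach-≤ : Reach D g h → toℕ h ≤ toℕ g
  reach-≤ ε       = ≤-refl
  reach-≤ (e ◅ R) = ≤-trans (reach-≤ R) (<⇒≤ (acyclic D e))

  successor : label D g ≡ gate o l r → ∀ s → Edge (label D) g (pick s l r)
  successor e left  = edgeˡ e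
  successor e right = edgeʳ e

  sibling : label D g ≡ gate o l r → ∀ s → Edge (label D) g (pick s r l)
  sibling e left  = edgeʳ e
  sibling e right = edgeˡ e

  literal-has-no-edge : label D g ≡ lit p x → ¬ Edge (label D) g h
  literal-has-no-edge e (edgeˡ e′) with () ← trans (sym e) e′
  literal-has-no-edge e (edgeʳ e′) with () ← trans (sym e) e′

  SatLabel : (Fin n → Bool) → Label n (size D) → Set
  SatLabel a (const b)     = b ≡ true
  SatLabel a (lit p x)     = a x ≡ p
  SatLabel a (gate ∧g l r) = Sat D a l × Sat D a r
  SatLabel a (gate ∨g l r) = Sat D a l ⊎ Sat D a r

  sat-unfold : Sat D a g → SatLabel a (label D g)
  sat-unfold (sat-const e)   rewrite e = refl
  sat-unfold (sat-lit e v)   rewrite e = v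
  sat-unfold (sat-and e s t) rewrite e = s , t
  sat-unfold (sat-orˡ e s)   rewrite e = inj₁ s
  sat-unfold (sat-orʳ e s)   rewrite e = inj₂ s

  sat-fold : SatLabel a (label D g) → Sat D a g
  sat-fold {g = g} s with label D g in e
  sat-fold ()       | const false
  sat-fold _        | const true  = sat-const e
  sat-fold v        | lit _ _     = sat-lit e v
  sat-fold (s , t)  | gate ∧g _ _ = sat-and e s t
  sat-fold (inj₁ s) | gate ∨g _ _ = sat-orˡ e s
  sat-fold (inj₂ s) | gate ∨g _ _ = sat-orʳ e s

  sat? : ∀ a g → Dec (Sat D a g)
  sat? a = nnf-induction (Dec ∘ Sat D a) λ g ih → map′ sat-fold sat-unfold (label? g ih)
    where
    label? : ∀ g → (∀ {h} → Edge (label D) g h → Dec (Sat D a h)) →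
             Dec (SatLabel a (label D g))
    label? g ih with label D g in e
    ... | const b     = b Bool.≟ true
    ... | lit p x     = a x Bool.≟ p
    ... | gate ∧g l r = ih (edgeˡ e) ×-dec ih (edgeʳ e)
    ... | gate ∨g l r = ih (edgeˡ e) ⊎-dec ih (edgeʳ e)

  MentionsLabel : Fin n → Bool → Label n (size D) → Set
  MentionsLabel x p (const _)    = ⊥
  MentionsLabel x p (lit q y)    = q ≡ p × y ≡ x
  MentionsLabel x p (gate _ l r) = Mentions D l x p ⊎ Mentions D r x p

  mentions-◅◅ : Reach D g h → Mentions D h x p → Mentions D g x p
  mentions-◅◅ R (s , R′ , e) = s , R ◅◅ R′ , e

  mentions-unfold : Mentions D g x p → MentionsLabel x p (label D g)
  mentions-unfold (_ , ε , e)            rewrite e = refl , refl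
  mentions-unfold (s , edgeˡ e ◅ R , e′) rewrite e = inj₁ (s , R , e′)
  mentions-unfold (s , edgeʳ e ◅ R , e′) rewrite e = inj₂ (s , R , e′)

  mentions-fold : MentionsLabel x p (label D g) → Mentions D g x p
  mentions-fold {g = g} m with label D g in e
  mentions-fold {g = g} (refl , refl) | lit _ _    = g , ε , e
  mentions-fold         (inj₁ M)      | gate _ _ _ = mentions-◅◅ (edgeˡ e ◅ ε) M
  mentions-fold         (inj₂ M)      | gate _ _ _ = mentions-◅◅ (edgeʳ e ◅ ε) M

  mentions? : ∀ g x p → Dec (Mentions D g x p)
  mentions? g x p = nnf-induction (λ g → Dec (Mentions D g x p))
                                  (λ g ih → map′ mentions-fold mentions-unfold (label? g ih)) g
    where
    label? : ∀ g → (∀ {h} → Edge (label D) g h → Dec (Mentions D h x p)) →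
             Dec (MentionsLabel x p (label D g))
    label? g ih with label D g in e
    ... | const _    = no λ ()
    ... | lit q y    = (q Bool.≟ p) ×-dec (y ≟ x)
    ... | gate _ _ _ = ih (edgeˡ e) ⊎-dec ih (edgeʳ e)

  var? : ∀ g x → Dec (Var D g x)
  var? g x = map′ [ (true ,_) , (false ,_) ] polarity
                  (mentions? g x true ⊎-dec mentions? g x false)
    where
    polarity : Var D g x → Mentions D g x true ⊎ Mentions D g x false
    polarity (true  , M) = inj₁ M
    polarity (false , M) = inj₂ M

  var-sibling : label D g ≡ gate o l r → ∀ s →
                Var D g x → ¬ Var D (pick s l r) x → Var D (pick s r l) x
  var-sibling e s (p , M) ¬V with s | subst (MentionsLabel _ p) e (mentions-unfold M)
  ... | left  | inj₁ Ml = ⊥-elim (¬V (p , Ml))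
  ... | left  | inj₂ Mr = p , Mr
  ... | right | inj₁ Ml = p , Ml
  ... | right | inj₂ Mr = ⊥-elim (¬V (p , Mr))

  sink-polarity-unique : IsSink (label D g) → Mentions D g x true → Mentions D g x false → ⊥
  sink-polarity-unique {g} sink M⁺ M⁻ with label D g | mentions-unfold M⁺ | mentions-unfold M⁻
  ... | const _    | ()       | _
  ... | lit _ _    | refl , _ | ()
  ... | gate _ _ _ | _        | _ = sink

  polarity-unique : WeaklyDecomposable D → label D g ≡ gate ∧g l r →
                    Mentions D l x p → Mentions D r x q → p ≡ q
  polarity-unique {p = true}  {q = true}  _ _ _ _ = refl
  polarity-unique {p = false} {q = false} _ _ _ _ = refl
  polarity-unique {g} {l} {r} {x} {true} {false} wd e Ml Mr =
    ⊥-elim (wd g l r e x (_ , Ml) (_ , Mr) (mentions-◅◅ (edgeˡ e ◅ ε) Ml)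
                                           (mentions-◅◅ (edgeʳ e ◅ ε) Mr))
  polarity-unique {g} {l} {r} {x} {false} {true} wd e Ml Mr =
    ⊥-elim (wd g l r e x (_ , Ml) (_ , Mr) (mentions-◅◅ (edgeʳ e ◅ ε) Mr)
                                           (mentions-◅◅ (edgeˡ e ◅ ε) Ml))

  term-edge⇒edge : TermEdge D ch g h → Edge (label D) g h
  term-edge⇒edge (t-andˡ e)  = edgeˡ e
  term-edge⇒edge (t-andʳ e)  = edgeʳ e
  term-edge⇒edge (t-orˡ e _) = edgeˡ e
  term-edge⇒edge (t-orʳ e _) = edgeʳ e

  term-path⇒reach : Star (TermEdge D ch) g h → Reach D g h
  term-path⇒reach = Star.map term-edge⇒edge

  and-term-edge : label D g ≡ gate ∧g l r → ∀ s → TermEdge D ch g (pick s l r)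
  and-term-edge e left  = t-andˡ e
  and-term-edge e right = t-andʳ e

  chosen-edge : label D g ≡ gate ∨g l r → TermEdge D ch g (pick (sideOf (ch g)) l r)
  chosen-edge {g = g} {ch = ch} e with ch g in c
  ... | true  = t-orˡ e c
  ... | false = t-orʳ e c

  chosen-only : label D g ≡ gate ∨g l r → TermEdge D ch g v → v ≡ pick (sideOf (ch g)) l r
  chosen-only e (t-andˡ e′)  with () ← trans (sym e) e′
  chosen-only e (t-andʳ e′)  with () ← trans (sym e) e′
  chosen-only e (t-orˡ e′ c) rewrite c with refl ← trans (sym e) e′ = refl
  chosen-only e (t-orʳ e′ c) rewrite c with refl ← trans (sym e) e′ = refl

  term-edges-fork : TermEdge D ch u v → TermEdge D ch u w →
                    v ≡ w ⊎ ∃₂ λ l r → label D u ≡ gate ∧g l r ×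
                                       (v ≡ l × w ≡ r ⊎ v ≡ r × w ≡ l)
  term-edges-fork t@(t-orˡ e _) t′ = inj₁ (trans (chosen-only e t) (sym (chosen-only e t′)))
  term-edges-fork t@(t-orʳ e _) t′ = inj₁ (trans (chosen-only e t) (sym (chosen-only e t′)))
  term-edges-fork t t′@(t-orˡ e _) = inj₁ (trans (chosen-only e t) (sym (chosen-only e t′)))
  term-edges-fork t t′@(t-orʳ e _) = inj₁ (trans (chosen-only e t) (sym (chosen-only e t′)))
  term-edges-fork (t-andˡ e) (t-andˡ e′) with refl ← trans (sym e) e′ = inj₁ refl
  term-edges-fork (t-andʳ e) (t-andʳ e′) with refl ← trans (sym e) e′ = inj₁ refl
  term-edges-fork (t-andˡ e) (t-andʳ e′) with refl ← trans (sym e) e′ =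
    inj₂ (_ , _ , e , inj₁ (refl , refl))
  term-edges-fork (t-andʳ e) (t-andˡ e′) with refl ← trans (sym e) e′ =
    inj₂ (_ , _ , e , inj₂ (refl , refl))

  direction : Edge (label D) g h → Bool
  direction (edgeˡ _) = true
  direction (edgeʳ _) = false

  term-edge : (e : Edge (label D) g h) → ch g ≡ direction e → TermEdge D ch g h
  term-edge (edgeˡ {o = ∧g} e) _ = t-andˡ e
  term-edge (edgeˡ {o = ∨g} e) c = t-orˡ e c
  term-edge (edgeʳ {o = ∧g} e) _ = t-andʳ e
  term-edge (edgeʳ {o = ∨g} e) c = t-orʳ e c

  term-edge-cong : ∀ {ch′} → ch g ≡ ch′ g → TermEdge D ch g h → TermEdge D ch′ g h
  term-edge-cong c (t-andˡ e)   = t-andˡ e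
  term-edge-cong c (t-andʳ e)   = t-andʳ e
  term-edge-cong c (t-orˡ e c′) = t-orˡ e (trans (sym c) c′)
  term-edge-cong c (t-orʳ e c′) = t-orʳ e (trans (sym c) c′)

  term-path-cong : ∀ {ch′} → (∀ {z} → Reach D g z → ch z ≡ ch′ z) →
                   Star (TermEdge D ch) g h → Star (TermEdge D ch′) g h
  term-path-cong agree ε       = ε
  term-path-cong agree (t ◅ P) =
    term-edge-cong (agree ε) t ◅ term-path-cong (agree ∘ (term-edge⇒edge t ◅_)) P

  choiceAlong : Reach D g h → Choice D
  choiceAlong ε           _ = true
  choiceAlong {g} (e ◅ P) z = if does (z ≟ g) then direction e else choiceAlong P z

  path⇒term : (P : Reach D g h) → Star (TermEdge D (choiceAlong P)) g h
  path⇒term ε           = ε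
  path⇒term {g} (e ◅ P) = term-edge e here ◅ term-path-cong below (path⇒term P)
    where
    here : choiceAlong (e ◅ P) g ≡ direction e
    here with g ≟ g
    ... | yes _  = refl
    ... | no g≢g = ⊥-elim (g≢g refl)
    -- by acyclicity, nothing below the rest of the path is its start g
    below : ∀ {z} → Reach D _ z → choiceAlong P z ≡ choiceAlong (e ◅ P) z
    below {z} R with z ≟ g
    ... | yes refl = ⊥-elim (<-irrefl refl (≤-<-trans (reach-≤ R) (acyclic D e)))
    ... | no _     = refl

  satChoice : (Fin n → Bool) → Choice D
  satChoice a g = choose (label D g)
    where
    choose : Label n (size D) → Bool
    choose (gate ∨g l _) = does (sat? a l)
    choose _             = true

  satChoice-reflects : ∀ {a g l r} → label D g ≡ gate ∨g l r →
                       if satChoice a g then Sat D a l else ¬ Sat D a l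
  satChoice-reflects {a = a} {l = l} e rewrite e = invert (proof (sat? a l))

  sat-term-edge : Sat D a g → TermEdge D (satChoice a) g h → Sat D a h
  sat-term-edge s (t-andˡ e)  = proj₁ (subst (SatLabel _) e (sat-unfold s))
  sat-term-edge s (t-andʳ e)  = proj₂ (subst (SatLabel _) e (sat-unfold s))
  sat-term-edge s (t-orˡ e c) = subst (λ b → if b then _ else _) c (satChoice-reflects e)
  sat-term-edge s (t-orʳ e c) =
    [ ⊥-elim ∘ subst (λ b → if b then _ else _) c (satChoice-reflects e) , id ]
      (subst (SatLabel _) e (sat-unfold s))

  sat-term-path : Sat D a g → Star (TermEdge D (satChoice a)) g h → Sat D a h
  sat-term-path s ε       = s
  sat-term-path s (t ◅ P) = sat-term-path (sat-term-edge s t) P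

  module _ (wd : WeaklyDecomposable D) {g c h x p}
           (only-c : ∀ {v} → TermEdge D ch g v → v ≡ c) (¬Vc : ¬ Var D c x)
           (e : Edge (label D) g h) (M : Mentions D h x p) where

    private
      g-mentions : Mentions D g x p
      g-mentions = mentions-◅◅ (e ◅ ε) M

    -- Walk down two term paths from u together until they branch: the branching node is an
    -- ∧-node whose sides mention x with polarities p and q. Neither path can be a prefix of
    -- the other, as x ∉ var(c) and g is not a literal.
    polarity-forced : Star (TermEdge D ch) u g → Star (TermEdge D ch) u s →
                      label D s ≡ lit q x → q ≡ p
    polarity-forced ε ε ls = ⊥-elim (literal-has-no-edge ls e)
    polarity-forced ε (t ◅ Q) ls with refl ← only-c t =
      ⊥-elim (¬Vc (_ , _ , term-path⇒reach Q , ls))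
    polarity-forced (t ◅ P) ε ls = ⊥-elim (literal-has-no-edge ls (term-edge⇒edge t))
    polarity-forced (t ◅ P) (t′ ◅ Q) ls with term-edges-fork t t′
    ... | inj₁ refl = polarity-forced P Q ls
    ... | inj₂ (_ , _ , u∧ , inj₁ (refl , refl)) =
      sym (polarity-unique wd u∧ (mentions-◅◅ (term-path⇒reach P) g-mentions)
                                 (_ , term-path⇒reach Q , ls))
    ... | inj₂ (_ , _ , u∧ , inj₂ (refl , refl)) =
      polarity-unique wd u∧ (_ , term-path⇒reach Q , ls)
                            (mentions-◅◅ (term-path⇒reach P) g-mentions)

  forced-literal : WeaklyDecomposable D → UniformTermVars D →
                   InTerm D ch g → (∀ {v} → TermEdge D ch g v → v ≡ c) → ¬ Var D c x →
                   Edge (label D) g h → Mentions D h x p →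
                   ∃ λ s → InTerm D ch s × label D s ≡ lit p x
  forced-literal {ch = ch} {g = g} {x = x} {p = p} wd uniform Pg only-c ¬Vc e M@(_ , R , ls′)
    with proj₁ (uniform (choiceAlong Q) ch x) (_ , p , path⇒term Q , ls′)
    where Q = reach-all D g ◅◅ e ◅ R
  ... | s , _ , Ts , ls =
    s , Ts , subst (λ q → label D s ≡ lit q x) (polarity-forced wd only-c ¬Vc e M Pg Ts ls) ls

-- Circuits over an arbitrary type of nodes, and their numbering as NNFs

data Lab (n : ℕ) (N : Set) : Set where
  const : Bool → Lab n N
  lit   : Bool → Fin n → Lab n N
  gate  : Op → N → N → Lab n N

relabel : ∀ {n k} {N : Set} → (N → Fin k) → Lab n N → Label n k
relabel f (const b)    = const b
relabel f (lit p x)    = lit p x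
relabel f (gate o v w) = gate o (f v) (f w)

module Circuit {n : ℕ} {N : Set} (L : N → Lab n N) where

  private
    variable
      u v w : N
      o : Op

  data Edge* : N → N → Set where
    edgeˡ : L u ≡ gate o v w → Edge* u v
    edgeʳ : L u ≡ gate o v w → Edge* u w

  Reach* : N → N → Set
  Reach* = Star Edge*

  Mentions* : N → Fin n → Bool → Set
  Mentions* u x p = ∃ λ v → Reach* u v × L v ≡ lit p x

  Var* : N → Fin n → Set
  Var* u x = ∃ λ p → Mentions* u x p

  data Sat* (a : Fin n → Bool) : N → Set where
    sat-const : L u ≡ const true → Sat* a u
    sat-lit   : ∀ {p x} → L u ≡ lit p x → a x ≡ p → Sat* a u
    sat-and   : L u ≡ gate ∧g v w → Sat* a v → Sat* a w → Sat* a u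
    sat-orˡ   : L u ≡ gate ∨g v w → Sat* a v → Sat* a u
    sat-orʳ   : L u ≡ gate ∨g v w → Sat* a w → Sat* a u

  Smooth* : Set
  Smooth* =
    ∀ u v w → L u ≡ gate ∨g v w → ∀ x → (Var* v x → Var* w x) × (Var* w x → Var* v x)

  WeaklyDecomposable* : Set
  WeaklyDecomposable* =
    ∀ u v w → L u ≡ gate ∧g v w →
    ∀ x → Var* v x → Var* w x → Mentions* u x true → Mentions* u x false → ⊥

  Deterministic* : Set
  Deterministic* = ∀ u v w → L u ≡ gate ∨g v w → ∀ a → Sat* a v → Sat* a w → ⊥

  mentions*-◅◅ : ∀ {x p} → Reach* u v → Mentions* v x p → Mentions* u x p
  mentions*-◅◅ R (s , R′ , e) = s , R ◅◅ R′ , e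

module Numbering {n k : ℕ} {N : Set} (L : N → Lab n N) (ι : Fin k ↔ N)
                 (descending : ∀ {u v} → Circuit.Edge* L u v →
                               Inverse.from ι v <ᶠ Inverse.from ι u)
                 (src : N) (reach : ∀ u → Circuit.Reach* L src u) where

  open Circuit L
  open Inverse ι using (to; from; strictlyInverseˡ; strictlyInverseʳ)

  private
    variable
      u v : N
      i j l r : Fin k
      o : Op
      a : Fin n → Bool
      lb : Lab n N
      x : Fin n
      p : Bool

  numberedLabel : Fin k → Label n k
  numberedLabel i = relabel from (L (to i))

  label-from : L u ≡ lb → numberedLabel (from u) ≡ relabel from lb
  label-from {u} e = trans (cong (relabel from ∘ L) (strictlyInverseˡ u)) (cong (relabel from) e)

  const-to : ∀ {b} → numberedLabel i ≡ const b → L (to i) ≡ const b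
  const-to {i} e with L (to i)
  const-to refl | const _ = refl

  lit-to : numberedLabel i ≡ lit p x → L (to i) ≡ lit p x
  lit-to {i} e with L (to i)
  lit-to refl | lit _ _ = refl

  gate-to : numberedLabel i ≡ gate o l r → L (to i) ≡ gate o (to l) (to r)
  gate-to {i} e with L (to i)
  gate-to refl | gate o v w = sym (cong₂ (gate o) (strictlyInverseˡ v) (strictlyInverseˡ w))

  edge-to : Edge numberedLabel i j → Edge* (to i) (to j)
  edge-to (edgeˡ e) = edgeˡ (gate-to e)
  edge-to (edgeʳ e) = edgeʳ (gate-to e)

  edge-from : Edge* u v → Edge numberedLabel (from u) (from v)
  edge-from (edgeˡ e) = edgeˡ (label-from e)
  edge-from (edgeʳ e) = edgeʳ (label-from e)

  numbered : NNF n
  numbered = record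
    { size      = k
    ; label     = numberedLabel
    ; source    = from src
    ; acyclic   = λ e → subst₂ (λ j i → toℕ j < toℕ i)
                               (strictlyInverseʳ _) (strictlyInverseʳ _) (descending (edge-to e))
    ; reach-all = λ i → subst (Star (Edge numberedLabel) (from src)) (strictlyInverseʳ i)
                              (Star.gmap from edge-from (reach (to i)))
    }

  mentions-to : Mentions numbered i x p → Mentions* (to i) x p
  mentions-to (j , R , e) = to j , Star.gmap to edge-to R , lit-to e

  var-to : Var numbered i x → Var* (to i) x
  var-to (p , M) = p , mentions-to M

  var-from : Var* (to i) x → Var numbered i x
  var-from {i} (p , v , R , e) =
    p , from v ,
    subst (λ j → Reach numbered j (from v)) (strictlyInverseʳ i) (Star.gmap from edge-from R) ,
    label-from e

  sat-to : Sat numbered a i → Sat* a (to i)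
  sat-to (sat-const e)   = sat-const (const-to e)
  sat-to (sat-lit e v)   = sat-lit (lit-to e) v
  sat-to (sat-and e s t) = sat-and (gate-to e) (sat-to s) (sat-to t)
  sat-to (sat-orˡ e s)   = sat-orˡ (gate-to e) (sat-to s)
  sat-to (sat-orʳ e s)   = sat-orʳ (gate-to e) (sat-to s)

  sat-from : Sat* a u → Sat numbered a (from u)
  sat-from (sat-const e)   = sat-const (label-from e)
  sat-from (sat-lit e v)   = sat-lit (label-from e) v
  sat-from (sat-and e s t) = sat-and (label-from e) (sat-from s) (sat-from t)
  sat-from (sat-orˡ e s)   = sat-orˡ (label-from e) (sat-from s)
  sat-from (sat-orʳ e s)   = sat-orʳ (label-from e) (sat-from s)

  numbered-computes : ∀ a →
    (Computes numbered a → Sat* a src) × (Sat* a src → Computes numbered a)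
  numbered-computes a = subst (Sat* a) (strictlyInverseˡ src) ∘ sat-to , sat-from

  numbered-smooth : Smooth* → Smooth numbered
  numbered-smooth smooth i l r e x =
    var-from ∘ proj₁ (smooth _ _ _ (gate-to e) x) ∘ var-to ,
    var-from ∘ proj₂ (smooth _ _ _ (gate-to e) x) ∘ var-to

  numbered-weaklyDecomposable : WeaklyDecomposable* → WeaklyDecomposable numbered
  numbered-weaklyDecomposable wd i l r e x Vl Vr M⁺ M⁻ =
    wd _ _ _ (gate-to e) x (var-to Vl) (var-to Vr) (mentions-to M⁺) (mentions-to M⁻)

  numbered-deterministic : Deterministic* → Deterministic numbered
  numbered-deterministic det i l r e a s t = det _ _ _ (gate-to e) a (sat-to s) (sat-to t)

module Smoothing {n : ℕ} (D : NNF n) where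

  open Properties D

  data Cell : Set where
    base top : Cell
    chain    : Side → Fin (suc n) → Cell
    atom     : Side → Fin n → Cell

  Node : Set
  Node = Fin (size D) × Cell

  last : Fin (suc n)
  last = fromℕ n

  Missing : (this other : Fin (size D)) → Fin n → Set
  Missing this other x = ¬ Var D this x × Var D other x

  missing? : ∀ this other x → Dec (Missing this other x)
  missing? this other x = ¬? (var? this x) ×-dec var? other x

  padding : ∀ {this other x} → Dec (Missing this other x) → Lab n Node
  padding {x = x} (yes (_ , p , _)) = lit p x
  padding         (no _)            = const true

  opOf : Label n (size D) → Op
  opOf (gate o _ _) = o
  opOf _            = ∧g

  -- A sink stands in for both of its (missing) successors; its base cell is a copy of it.
  successorOf : Fin (size D) → Label n (size D) → Side → Fin (size D)
  successorOf g (gate _ l r) s = pick s l r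
  successorOf g _            _ = g

  entryOf : Fin (size D) → Label n (size D) → Side → Node
  entryOf g (gate _ l r) s = pick s l r , top
  entryOf g _            _ = g , base

  baseLabel : Label n (size D) → Lab n Node
  baseLabel (const b)    = const b
  baseLabel (lit p x)    = lit p x
  baseLabel (gate _ _ _) = const true

  atomLabel : Label n (size D) → Side → Fin n → Lab n Node
  atomLabel (gate ∨g l r) s x = padding (missing? (pick s l r) (pick s r l) x)
  atomLabel _             _ _ = const true

  -- chain s j is the conjunction of the entry of side s, the base cell and the atoms below j.
  cellLabel : Fin (size D) → Label n (size D) → Cell → Lab n Node
  cellLabel g lb base              = baseLabel lb
  cellLabel g lb top               = gate (opOf lb) (g , chain left last) (g , chain right last)
  cellLabel g lb (chain s zero)    = gate ∧g (entryOf g lb s) (g , base)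
  cellLabel g lb (chain s (suc i)) = gate ∧g (g , atom s i) (g , chain s (inject₁ i))
  cellLabel g lb (atom s x)        = atomLabel lb s x

  L : Node → Lab n Node
  L (g , c) = cellLabel g (label D g) c

  open Circuit L

  private
    variable
      a : Fin n → Bool
      g h l r : Fin (size D)
      c : Cell
      lb : Label n (size D)
      o : Op
      s : Side
      u v w : Node
      x : Fin n
      p : Bool

  L-at : label D g ≡ lb → ∀ c → L (g , c) ≡ cellLabel g lb c
  L-at e c = cong (λ lb → cellLabel _ lb c) e

  successor-gate : label D g ≡ gate o l r → ∀ s → successorOf g (label D g) s ≡ pick s l r
  successor-gate e s rewrite e = refl

  successor-sink : IsSink (label D g) → ∀ s → successorOf g (label D g) s ≡ g
  successor-sink {g} sink s with label D g
  ... | const _ = refl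
  ... | lit _ _ = refl

  data GateCell (g : Fin (size D)) : Cell → Op → Node → Node → Set where
    top-gate   : label D g ≡ gate o l r →
                 GateCell g top o (g , chain left last) (g , chain right last)
    top-sink   : IsSink (label D g) →
                 GateCell g top ∧g (g , chain left last) (g , chain right last)
    chain-gate : label D g ≡ gate o l r → ∀ s →
                 GateCell g (chain s zero) ∧g (pick s l r , top) (g , base)
    chain-sink : IsSink (label D g) → ∀ s →
                 GateCell g (chain s zero) ∧g (g , base) (g , base)
    chain-atom : ∀ s i →
                 GateCell g (chain s (suc i)) ∧g (g , atom s i) (g , chain s (inject₁ i))

  gate-cell : L (g , c) ≡ gate o v w → GateCell g c o v w
  gate-cell {g} {base} e with label D g
  gate-cell () | const _
  gate-cell () | lit _ _
  gate-cell () | gate _ _ _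
  gate-cell {g} {top} e with label D g in eq
  gate-cell refl | const _    = top-sink (subst IsSink (sym eq) tt)
  gate-cell refl | lit _ _    = top-sink (subst IsSink (sym eq) tt)
  gate-cell refl | gate _ _ _ = top-gate eq
  gate-cell {g} {chain s zero} e with label D g in eq
  gate-cell {c = chain s zero} refl | const _    = chain-sink (subst IsSink (sym eq) tt) s
  gate-cell {c = chain s zero} refl | lit _ _    = chain-sink (subst IsSink (sym eq) tt) s
  gate-cell {c = chain s zero} refl | gate _ _ _ = chain-gate eq s
  gate-cell {c = chain s (suc i)} refl = chain-atom s i
  gate-cell {g} {atom s x} e with label D g
  gate-cell () | const _
  gate-cell () | lit _ _
  gate-cell () | gate ∧g _ _
  gate-cell {c = atom s x} e | gate ∨g l r with missing? (pick s l r) (pick s r l) x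
  gate-cell () | gate ∨g l r | yes _
  gate-cell () | gate ∨g l r | no _

  atom-literal : ∀ {y} → L (g , atom s x) ≡ lit p y →
                 x ≡ y × ∃₂ λ l r → label D g ≡ gate ∨g l r ×
                                    ¬ Var D (pick s l r) x × Mentions D (pick s r l) x p
  atom-literal {g} e with label D g
  atom-literal () | const _
  atom-literal () | lit _ _
  atom-literal () | gate ∧g _ _
  atom-literal {s = s} {x} e | gate ∨g l r with missing? (pick s l r) (pick s r l) x
  atom-literal refl | gate ∨g l r | yes (¬V , _ , M) = refl , l , r , refl , ¬V , M
  atom-literal ()   | gate ∨g l r | no _

  atom-variable : label D g ≡ gate ∨g l r → Missing (pick s l r) (pick s r l) x →
                  ∃ λ p → L (g , atom s x) ≡ lit p x
  atom-variable {l = l} {r} {s} {x} e m rewrite e with missing? (pick s l r) (pick s r l) x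
  ... | yes (_ , p , _) = p , refl
  ... | no ¬m           = ⊥-elim (¬m m)

  -- Numbering: the cells of a block form an (n+1) × 4 grid numbered row by row, so that every
  -- edge leads to a smaller number and top is the last cell; blocks follow the order of D.

  chainColumn : Side → Fin 4
  chainColumn left  = 1F
  chainColumn right = 2F

  atomPosition : Side → Fin n → Fin (suc n) × Fin 4
  atomPosition left  i = inject₁ i , 3F
  atomPosition right i = suc i , 0F

  cellPosition : Cell → Fin (suc n) × Fin 4
  cellPosition base        = zero , 0F
  cellPosition top         = last , 3F
  cellPosition (chain s j) = j , chainColumn s
  cellPosition (atom s i)  = atomPosition s i

  firstColumn : Fin (suc n) → Cell
  firstColumn zero    = base
  firstColumn (suc i) = atom right i

  lastColumn : {j : Fin (suc n)} → View j → Cell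
  lastColumn ‵fromℕ       = top
  lastColumn (‵inject₁ i) = atom left i

  cellAt : Fin (suc n) × Fin 4 → Cell
  cellAt (j , 0F) = firstColumn j
  cellAt (j , 1F) = chain left j
  cellAt (j , 2F) = chain right j
  cellAt (j , 3F) = lastColumn (view j)

  cellAt-position : ∀ c → cellAt (cellPosition c) ≡ c
  cellAt-position base            = refl
  cellAt-position top             rewrite view-fromℕ n = refl
  cellAt-position (chain left j)  = refl
  cellAt-position (chain right j) = refl
  cellAt-position (atom left i)   rewrite view-inject₁ i = refl
  cellAt-position (atom right i)  = refl

  position-cellAt : ∀ q → cellPosition (cellAt q) ≡ q
  position-cellAt (zero  , 0F) = refl
  position-cellAt (suc _ , 0F) = refl
  position-cellAt (j     , 1F) = refl
  position-cellAt (j     , 2F) = refl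
  position-cellAt (j     , 3F) with view j
  ... | ‵fromℕ     = refl
  ... | ‵inject₁ _ = refl

  node↔ : Fin (size D * (suc n * 4)) ↔ Node
  node↔ = ↔-trans *↔× (↔-refl ×-↔ ↔-trans *↔×
                         (mk↔ₛ′ cellAt cellPosition cellAt-position position-cellAt))

  open Inverse node↔ using (from)

  _≺_ : Node → Node → Set
  u ≺ v = from u <ᶠ from v

  same-block : ∀ g c′ c → ×-Lex _≡_ _<ᶠ_ _<ᶠ_ (cellPosition c′) (cellPosition c) →
               (g , c′) ≺ (g , c)
  same-block g c′ c lt = combine-lex {i = g} {i′ = g} (inj₂ (refl , combine-lex lt))

  chain<top : ∀ s → toℕ (chainColumn s) < 3
  chain<top left  = s<s z<s
  chain<top right = s<s (s<s z<s)

  base<chain : ∀ s → 0 < toℕ (chainColumn s)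
  base<chain left  = z<s
  base<chain right = z<s

  chain≺top : ∀ g s → (g , chain s last) ≺ (g , top)
  chain≺top g s = same-block g (chain s last) top (inj₂ (refl , chain<top s))

  base≺chain : ∀ g s → (g , base) ≺ (g , chain s zero)
  base≺chain g s = same-block g base (chain s zero) (inj₂ (refl , base<chain s))

  chain≺chain : ∀ g s i → (g , chain s (inject₁ i)) ≺ (g , chain s (suc i))
  chain≺chain g s i =
    same-block g (chain s (inject₁ i)) (chain s (suc i)) (inj₁ (inject₁<suc i))

  atom≺chain : ∀ g s i → (g , atom s i) ≺ (g , chain s (suc i))
  atom≺chain g left  i = same-block g (atom left i) (chain left (suc i)) (inj₁ (inject₁<suc i))
  atom≺chain g right i = same-block g (atom right i) (chain right (suc i)) (inj₂ (refl , z<s))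

  successor≺chain : label D g ≡ gate o l r → ∀ s → (pick s l r , top) ≺ (g , chain s zero)
  successor≺chain {g} {l = l} {r} e s =
    combine-lex {i = pick s l r} {i′ = g} (inj₁ (acyclic D (successor e s)))

  gate-cell-descends : GateCell g c o v w → v ≺ (g , c) × w ≺ (g , c)
  gate-cell-descends {g} (top-gate _)     = chain≺top g left , chain≺top g right
  gate-cell-descends {g} (top-sink _)     = chain≺top g left , chain≺top g right
  gate-cell-descends {g} (chain-gate e s) = successor≺chain e s , base≺chain g s
  gate-cell-descends {g} (chain-sink _ s) = base≺chain g s , base≺chain g s
  gate-cell-descends {g} (chain-atom s i) = atom≺chain g s i , chain≺chain g s i

  descending : Edge* u v → v ≺ u
  descending {g , c} (edgeˡ e) = proj₁ (gate-cell-descends (gate-cell {g} {c} e))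
  descending {g , c} (edgeʳ e) = proj₂ (gate-cell-descends (gate-cell {g} {c} e))

  to-chain : ∀ g s → Edge* (g , top) (g , chain s last)
  to-chain g left  = edgeˡ refl
  to-chain g right = edgeʳ refl

  chain-descends : ∀ g s j → Reach* (g , chain s last) (g , chain s j)
  chain-descends g s = >-weakInduction _ ε (λ i R → R ◅◅ edgeʳ refl ◅ ε)

  chain-reaches-entry : ∀ g s j → Reach* (g , chain s j) (entryOf g (label D g) s)
  chain-reaches-entry g s = <-weakInduction _ (edgeˡ refl ◅ ε) (λ i R → edgeʳ refl ◅ R)

  chain-reaches-successor : label D g ≡ gate o l r → ∀ s j →
                            Reach* (g , chain s j) (pick s l r , top)
  chain-reaches-successor {g} e s j =
    subst (Reach* (g , chain s j)) (cong (λ lb → entryOf g lb s) e) (chain-reaches-entry g s j)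

  top-reaches : ∀ g c → Reach* (g , top) (g , c)
  top-reaches g base        = to-chain g left ◅ chain-descends g left zero ◅◅ edgeʳ refl ◅ ε
  top-reaches g top         = ε
  top-reaches g (chain s j) = to-chain g s ◅ chain-descends g s j
  top-reaches g (atom s i)  = to-chain g s ◅ chain-descends g s (suc i) ◅◅ edgeˡ refl ◅ ε

  lift-edge : Edge (label D) g h → Reach* (g , top) (h , top)
  lift-edge (edgeˡ {g} e) = to-chain g left ◅ chain-reaches-successor e left last
  lift-edge (edgeʳ {g} e) = to-chain g right ◅ chain-reaches-successor e right last

  lift-reach : Reach D g h → Reach* (g , top) (h , top)
  lift-reach = Star.concat ∘ Star.gmap (_, top) lift-edge

  reach*-all : ∀ u → Reach* (source D , top) u
  reach*-all (g , c) = lift-reach (reach-all D g) ◅◅ top-reaches g c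

  mentions*-top : Mentions D g x p → Mentions* (g , top) x p
  mentions*-top (h , R , e) = (h , base) , lift-reach R ◅◅ top-reaches h base , cong baseLabel e

  -- Soundness: a satisfied cell forces its D-counterpart (a chain only its successor)

  Meaning : (Fin n → Bool) → Node → Set
  Meaning a (g , top)       = Sat D a g
  Meaning a (g , base)      = IsSink (label D g) → Sat D a g
  Meaning a (g , chain s _) = Sat D a (successorOf g (label D g) s)
  Meaning a (g , atom _ _)  = ⊤

  const-sound : L (g , c) ≡ const true → Meaning a (g , c)
  const-sound {g} {base} e with label D g in eq
  ... | const true = λ _ → sat-const eq
  ... | gate _ _ _ = λ ()
  const-sound {c = top}             ()
  const-sound {c = chain _ zero}    ()
  const-sound {c = chain _ (suc _)} ()
  const-sound {c = atom _ _}        _ = tt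

  lit-sound : L (g , c) ≡ lit p x → a x ≡ p → Meaning a (g , c)
  lit-sound {g} {base} e v with label D g in eq
  lit-sound refl v | lit _ _ = λ _ → sat-lit eq v
  lit-sound {c = top}             ()
  lit-sound {c = chain _ zero}    ()
  lit-sound {c = chain _ (suc _)} ()
  lit-sound {c = atom _ _}        _ _ = tt

  and-sound : GateCell g c ∧g v w → Meaning a v → Meaning a w → Meaning a (g , c)
  and-sound (top-gate e) sl sr =
    sat-fold (subst (SatLabel _) (sym e) (subst (Sat D _) (successor-gate e left) sl ,
                                          subst (Sat D _) (successor-gate e right) sr))
  and-sound (top-sink sink)     sl _ = subst (Sat D _) (successor-sink sink left) sl
  and-sound (chain-gate e s)    sc _ = subst (Sat D _) (sym (successor-gate e s)) sc
  and-sound (chain-sink sink s) sb _ = subst (Sat D _) (sym (successor-sink sink s)) (sb sink)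
  and-sound (chain-atom s i)    _ sc = sc

  or-sound : GateCell g c ∨g v w → Meaning a v ⊎ Meaning a w → Meaning a (g , c)
  or-sound (top-gate e) m =
    sat-fold (subst (SatLabel _) (sym e) (Sum.map (subst (Sat D _) (successor-gate e left))
                                                  (subst (Sat D _) (successor-gate e right)) m))

  sound : Sat* a u → Meaning a u
  sound {u = g , c} (sat-const e)   = const-sound {g} {c} e
  sound {u = g , c} (sat-lit e v)   = lit-sound {g} {c} e v
  sound {u = g , c} (sat-and e s t) = and-sound (gate-cell {g} {c} e) (sound s) (sound t)
  sound {u = g , c} (sat-orˡ e s)   = or-sound (gate-cell {g} {c} e) (inj₁ (sound s))
  sound {u = g , c} (sat-orʳ e s)   = or-sound (gate-cell {g} {c} e) (inj₂ (sound s))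

  -- Literals below a cell: a chain below level j contains only the atoms of variables below j

  MayMention : Node → Fin n → Bool → Set
  MayMention (g , top)       x p = Mentions D g x p
  MayMention (g , base)      x p = label D g ≡ lit p x
  MayMention (g , chain s j) x p = Mentions D (successorOf g (label D g) s) x p ⊎
                                   (toℕ x < toℕ j × L (g , atom s x) ≡ lit p x)
  MayMention (g , atom s i)  x p = L (g , atom s i) ≡ lit p x

  literal-may-mention : L (g , c) ≡ lit p x → MayMention (g , c) x p
  literal-may-mention {g} {base} e with label D g
  literal-may-mention refl | lit _ _ = refl
  literal-may-mention {c = top}             ()
  literal-may-mention {c = chain _ zero}    ()
  literal-may-mention {c = chain _ (suc _)} ()
  literal-may-mention {c = atom _ _}        e = e

  chain-may-mention⇒mentions : label D g ≡ gate o l r → ∀ s j →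
                               MayMention (g , chain s j) x p → Mentions D g x p
  chain-may-mention⇒mentions e s j (inj₁ M) =
    mentions-◅◅ (successor e s ◅ ε) (subst (λ h → Mentions D h _ _) (successor-gate e s) M)
  chain-may-mention⇒mentions e s j (inj₂ (_ , al)) with atom-literal al
  ... | refl , _ , _ , e′ , _ , M with refl ← trans (sym e) e′ =
    mentions-◅◅ (sibling e s ◅ ε) M

  and-chain-may-mention : label D g ≡ gate ∧g l r → ∀ s j →
                          MayMention (g , chain s j) x p → Mentions D (pick s l r) x p
  and-chain-may-mention e s j (inj₁ M) = subst (λ h → Mentions D h _ _) (successor-gate e s) M
  and-chain-may-mention e s j (inj₂ (_ , al)) with atom-literal al
  ... | _ , _ , _ , e′ , _ with () ← trans (sym e) e′

  sink-chain-may-mention : IsSink (label D g) → ∀ s j →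
                           MayMention (g , chain s j) x p → Mentions D g x p
  sink-chain-may-mention sink s j (inj₁ M) =
    subst (λ h → Mentions D h _ _) (successor-sink sink s) M
  sink-chain-may-mention sink s j (inj₂ (_ , al)) with atom-literal al
  ... | _ , _ , _ , e′ , _ = ⊥-elim (subst IsSink e′ sink)

  may-mention-step : GateCell g c o v w → MayMention v x p ⊎ MayMention w x p →
                     MayMention (g , c) x p
  may-mention-step (top-gate e) =
    [ chain-may-mention⇒mentions e left last , chain-may-mention⇒mentions e right last ]
  may-mention-step (top-sink sink) =
    [ sink-chain-may-mention sink left last , sink-chain-may-mention sink right last ]
  may-mention-step (chain-gate e s) (inj₁ M) =
    inj₁ (subst (λ h → Mentions D h _ _) (sym (successor-gate e s)) M)
  may-mention-step (chain-gate e s) (inj₂ eb) with () ← trans (sym e) eb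
  may-mention-step {g} (chain-sink sink s) sb =
    inj₁ (subst (λ h → Mentions D h _ _) (sym (successor-sink sink s)) (g , ε , Sum.reduce sb))
  may-mention-step (chain-atom s i) (inj₁ al) with atom-literal al
  ... | refl , _ = inj₂ (≤-refl , al)
  may-mention-step (chain-atom s i) (inj₂ (inj₁ M))           = inj₁ M
  may-mention-step (chain-atom s i) (inj₂ (inj₂ (x<i , al))) =
    inj₂ (<-trans x<i (inject₁<suc i) , al)

  may-mention : Mentions* u x p → MayMention u x p
  may-mention {g , c} (_ , ε , e) = literal-may-mention {g} {c} e
  may-mention {g , c} (v , edgeˡ e ◅ R , e′) =
    may-mention-step (gate-cell {g} {c} e) (inj₁ (may-mention (v , R , e′)))
  may-mention {g , c} (v , edgeʳ e ◅ R , e′) =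
    may-mention-step (gate-cell {g} {c} e) (inj₂ (may-mention (v , R , e′)))

  chain-last-var⇒ : label D g ≡ gate o l r → ∀ s → Var* (g , chain s last) x → Var D g x
  chain-last-var⇒ e s (p , M) = p , chain-may-mention⇒mentions e s last (may-mention M)

  chain-last-var⇐ : label D g ≡ gate ∨g l r → ∀ s → Var D g x → Var* (g , chain s last) x
  chain-last-var⇐ {g} {l} {r} {x} e s V with var? (pick s l r) x
  ... | yes (p , M) = p , mentions*-◅◅ (chain-reaches-successor e s last) (mentions*-top M)
  ... | no ¬V with atom-variable e (¬V , var-sibling e s V ¬V)
  ...   | p , al = p , (g , atom s x) , chain-descends g s (suc x) ◅◅ edgeˡ refl ◅ ε , al

  smooth* : Smooth*
  smooth* (g , c) v w e x with gate-cell {g} {c} e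
  ... | top-gate e′ = chain-last-var⇐ e′ right ∘ chain-last-var⇒ e′ left ,
                      chain-last-var⇐ e′ left ∘ chain-last-var⇒ e′ right

  weaklyDecomposable* : WeaklyDecomposable D → WeaklyDecomposable*
  weaklyDecomposable* wd (g , c) v w e x (p , Mv) (q , Mw) M⁺ M⁻ =
    cell-wd (gate-cell {g} {c} e) (may-mention Mv) (may-mention Mw)
            (may-mention M⁺) (may-mention M⁻)
    where
    cell-wd : GateCell g c ∧g v w → MayMention v x p → MayMention w x q →
              MayMention (g , c) x true → MayMention (g , c) x false → ⊥
    cell-wd (top-gate e′) Sl Sr S⁺ S⁻ =
      wd g _ _ e′ x (p , and-chain-may-mention e′ left last Sl)
                    (q , and-chain-may-mention e′ right last Sr) S⁺ S⁻
    cell-wd (top-sink sink) _ _ S⁺ S⁻ = sink-polarity-unique sink S⁺ S⁻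
    cell-wd (chain-gate e′ s) _ Sb _ _ with () ← trans (sym e′) Sb
    cell-wd (chain-sink sink s) _ _ S⁺ S⁻ =
      sink-polarity-unique sink (sink-chain-may-mention sink s zero S⁺)
                                (sink-chain-may-mention sink s zero S⁻)
    cell-wd (chain-atom s i) Sa Sc _ _ with atom-literal Sa
    ... | refl , _ , _ , e′ , ¬V , _ with Sc
    ...   | inj₁ M         = ¬V (q , subst (λ h → Mentions D h _ _) (successor-gate e′ s) M)
    ...   | inj₂ (x<x , _) = <-irrefl (sym (toℕ-inject₁ x)) x<x

  deterministic* : Deterministic D → Deterministic*
  deterministic* det (g , c) v w e a sl sr with gate-cell {g} {c} e
  ... | top-gate e′ = det g _ _ e′ a (subst (Sat D a) (successor-gate e′ left) (sound sl))
                                     (subst (Sat D a) (successor-gate e′ right) (sound sr))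

  -- Completeness, along the term selected by a satisfying assignment

  top-sat-or : L (g , top) ≡ gate ∨g (g , chain left last) (g , chain right last) →
               ∀ s → Sat* a (g , chain s last) → Sat* a (g , top)
  top-sat-or e left  = sat-orˡ e
  top-sat-or e right = sat-orʳ e

  module Completeness (wd : WeaklyDecomposable D) (uniform : UniformTermVars D)
                      {a : Fin n → Bool} (sat-source : Sat D a (source D)) where

    in-term-sat : InTerm D (satChoice a) g → label D g ≡ lb → SatLabel a lb
    in-term-sat T e = subst (SatLabel a) e (sat-unfold (sat-term-path sat-source T))

    chain-last-sat : label D g ≡ lb → ∀ s → Sat* a (entryOf g lb s) → Sat* a (g , base) →
                     (∀ i → Sat* a (g , atom s i)) → Sat* a (g , chain s last)
    chain-last-sat {g} e s se sb atoms =
      <-weakInduction (λ j → Sat* a (g , chain s j))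
        (sat-and refl (subst (Sat* a) (sym (cong (λ lb → entryOf g lb s) e)) se) sb)
        (λ i sc → sat-and refl (atoms i) sc) last

    sink-top-sat : label D g ≡ lb → IsSink lb → Sat* a (g , base) → Sat* a (g , top)
    sink-top-sat {lb = const _} e _ sb = sat-and (L-at e top) (side left) (side right)
      where side = λ t → chain-last-sat e t sb sb (λ i → sat-const (L-at e (atom t i)))
    sink-top-sat {lb = lit _ _} e _ sb = sat-and (L-at e top) (side left) (side right)
      where side = λ t → chain-last-sat e t sb sb (λ i → sat-const (L-at e (atom t i)))

    padding-sat : label D g ≡ gate ∨g l r → InTerm D (satChoice a) g →
                  ∀ i → Sat* a (g , atom (sideOf (satChoice a g)) i)
    padding-sat {g} {l} {r} e T i =
      atom-sat (missing? (pick side l r) (pick side r l) i) (L-at e (atom side i))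
      where
      side = sideOf (satChoice a g)
      atom-sat : (d : Dec (Missing (pick side l r) (pick side r l) i)) →
                 L (g , atom side i) ≡ padding d → Sat* a (g , atom side i)
      atom-sat (no _) al = sat-const al
      atom-sat (yes (¬V , p , M)) al
        with forced-literal wd uniform T (chosen-only e) ¬V (sibling e side) M
      ... | _ , Tt , lt = sat-lit al (in-term-sat Tt lt)

    complete : ∀ g → InTerm D (satChoice a) g → Sat* a (g , top)
    complete = nnf-induction _ λ g ih T → top-sat g ih T
      where
      top-sat : ∀ g →
                (∀ {h} → Edge (label D) g h → InTerm D (satChoice a) h → Sat* a (h , top)) →
                InTerm D (satChoice a) g → Sat* a (g , top)
      top-sat g ih T with label D g in e
      ... | const false with () ← in-term-sat T e
      ... | const true  = sink-top-sat e tt (sat-const (L-at e base))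
      ... | lit _ _     = sink-top-sat e tt (sat-lit (L-at e base) (in-term-sat T e))
      ... | gate ∧g l r = sat-and (L-at e top) (side left) (side right)
        where
        side = λ t → chain-last-sat e t (ih (successor e t) (T ◅◅ and-term-edge e t ◅ ε))
                                       (sat-const (L-at e base))
                                       (λ i → sat-const (L-at e (atom t i)))
      ... | gate ∨g l r =
        top-sat-or (L-at e top) side
          (chain-last-sat e side (ih (successor e side) (T ◅◅ chosen-edge e ◅ ε))
                                 (sat-const (L-at e base)) (padding-sat e T))
        where side = sideOf (satChoice a g)

  open Numbering L node↔ descending (source D , top) reach*-all public
    using (numbered; numbered-smooth; numbered-weaklyDecomposable; numbered-deterministic)
  open Numbering L node↔ descending (source D , top) reach*-all using (numbered-computes)

  numbered-equivalent : WeaklyDecomposable D → UniformTermVars D → Equivalent D numbered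
  numbered-equivalent wd uniform a =
    (λ s → proj₂ (numbered-computes a) (Completeness.complete wd uniform s (source D) ε)) ,
    (λ s → sound (proj₁ (numbered-computes a) s))

proposition3 : ∃ λ (c : ℕ) → ∀ (n : ℕ) (D : NNF n) →
    WeaklyDecomposable D → UniformTermVars D →
    Σ (NNF n) λ D* →
      Smooth D* × WeaklyDecomposable D* × Equivalent D D* ×
      size D* ≤ c * suc n * size D ×
      (Deterministic D → Deterministic D*)
proposition3 = 4 , λ n D wd uniform →
  let open Smoothing D in
  numbered ,
  numbered-smooth smooth* ,
  numbered-weaklyDecomposable (weaklyDecomposable* wd) ,
  numbered-equivalent wd uniform ,
  ≤-reflexive (trans (*-comm (size D) _) (cong (_* size D) (*-comm (suc n) 4))) ,
  numbered-deterministic ∘ deterministic*
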